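{- Let $\kappa$ be a perfect field of characteristic $p>0$, let $q=p^a$ ($a\ge1$), and let $k\ge 0$ and $n$ be integers with either $k\ge1$ and $q^{k-1}\le n<q^k$, or $(n,k)=(0,0)$. Then for every $x\in\kappa((t))$: (1) $\displaystyle \phi_n(x)=\sum_{r=n}^{q^k-1}\binom{r}{n}(-t)^{r-n}\mathcal D_r(x)$; (2) $\displaystyle \mathcal D_n(x)=\sum_{r=n}^{q^k-1}\binom{r}{n}t^{r-n}\phi_r(x)$; (3) $\phi_{q^k-1}(x)=\mathcal D_{q^k-1}(x)$.
   Context: $\kappa((t))$ is the field of formal Laurent series in $t$ over $\kappa$. The Hasse derivatives are the $\kappa$-linear maps $\mathcal D_n\left(\sum_j x_jt^j\right)=\sum_j\binom{j}{n}x_jt^{j-n}$ (generalized binomial coefficients, reduced mod $p$). For an integer $r\ge0$, let $k_r$ denote the number of base-$q$ digits of $r$ (i.e. $q^{k_r-1}\le r<q^{k_r}$ for $r\ge1$, and $k_0=0$). The Cartier operator $\phi_r$ is the $\kappa$-linear map $\phi_r\left(\sum_{j}x_jt^j\right)=\sum_{j\in\mathbb Z,\ j\equiv r \ (\mathrm{mod}\ q^{k_r})}x_jt^{j-r}$; on $\kappa[[t]]$ this is $\phi_r(\sum_{i\ge0}x_it^i)=\sum_{i\ge0}x_{iq^{k_r}+r}t^{iq^{k_r}}$. In particular $\phi_0$ is the identity. -}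

module Defs where

open import Level using (Level)
open import Algebra.Bundles using (CommutativeRing)
open import Data.Nat as ℕ using (ℕ; zero; suc; _<ᵇ_)
open import Data.Nat.Combinatorics using (_C_)
open import Data.Nat.Divisibility using (_∣?_)
open import Data.Nat.Primality using (Prime)
open import Data.Integer as ℤ using (ℤ; +_; -[1+_]; ∣_∣)
open import Data.Product using (Σ; ∃; _×_)
open import Data.Bool using (if_then_else_)
open import Relation.Nullary using (¬_)
open import Relation.Nullary.Decidable using (⌊_⌋)

binomℤ : ℤ → ℕ → ℤ
binomℤ (+ m)    n = + (m C n)
binomℤ -[1+ m ] n = (ℤ.- + 1) ℤ.^ n ℤ.* + ((m ℕ.+ n) C n)

-- number of base-q digits k_r of r: the least k with r < q^k
-- (search with fuel r+1, which suffices for q ≥ 2 since r < 2^r)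
digitsSearch : ℕ → ℕ → ℕ → ℕ → ℕ
digitsSearch q r zero    k = k
digitsSearch q r (suc f) k = if r ℕ.<ᵇ q ℕ.^ k then k else digitsSearch q r f (suc k)

numDigits : ℕ → ℕ → ℕ
numDigits q r = digitsSearch q r (suc r) 0

module _ {c ℓ : Level} (R : CommutativeRing c ℓ) where
  open CommutativeRing R

  pow : Carrier → ℕ → Carrier
  pow x zero    = 1#
  pow x (suc m) = x * pow x m

  fromℕ : ℕ → Carrier
  fromℕ zero    = 0#
  fromℕ (suc m) = 1# + fromℕ m

  fromℤ : ℤ → Carrier
  fromℤ (+ m)      = fromℕ m
  fromℤ -[1+ m ]   = - fromℕ (suc m)

  IsField : Set (c Level.⊔ ℓ)
  IsField = (¬ (1# ≈ 0#)) × (∀ x → ¬ (x ≈ 0#) → ∃ λ y → (x * y) ≈ 1#)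

  HasCharacteristic : ℕ → Set ℓ
  HasCharacteristic p = fromℕ p ≈ 0#

  IsPerfect : ℕ → Set (c Level.⊔ ℓ)
  IsPerfect p = ∀ y → ∃ λ x → pow x p ≈ y

  IsLaurent : (ℤ → Carrier) → Set ℓ
  IsLaurent x = ∃ λ (N : ℤ) → ∀ j → j ℤ.< N → x j ≈ 0#

  LaurentSeries : Set (c Level.⊔ ℓ)
  LaurentSeries = Σ (ℤ → Carrier) IsLaurent

  -- finite sum  Σ_{r = lo}^{hi - 1} f r  (empty if hi ≤ lo)
  sumFromTo : ℕ → ℕ → (ℕ → Carrier) → Carrier
  sumFromTo lo zero f = 0#
  sumFromTo lo (suc hi) f = if hi ℕ.<ᵇ lo then 0# else (sumFromTo lo hi f + f hi)

  hasse : ℕ → (ℤ → Carrier) → (ℤ → Carrier)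
  hasse n x i = fromℤ (binomℤ (i ℤ.+ + n) n) * x (i ℤ.+ + n)

  cartier : ℕ → ℕ → (ℤ → Carrier) → (ℤ → Carrier)
  cartier q r x i =
    if ⌊ (q ℕ.^ numDigits q r) ∣? ∣ i ∣ ⌋ then x (i ℤ.+ + r) else 0#

  -- multiplication by a scalar c times t^m:  (c t^m y)_i = c · y_{i-m}
  scaleShift : Carrier → ℕ → (ℤ → Carrier) → (ℤ → Carrier)
  scaleShift a m y i = a * y (i ℤ.- + m)

  eqₛ : (ℤ → Carrier) → (ℤ → Carrier) → Set ℓ
  eqₛ x y = ∀ i → x i ≈ y i

  sumSeries : ℕ → ℕ → (ℕ → ℤ → Carrier) → (ℤ → Carrier)
  sumSeries lo hi F i = sumFromTo lo hi (λ r → F r i)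

{-# OPTIONS --safe #-}
-- Compare coefficients of t^i. Put Q = q^k = p^(ak), j = i + n and j₀ = j mod Q. Every r with
-- n ≤ r < Q has exactly k base-q digits, so the t^i-coefficient of φ_r x is x_{i+r} when Q ∣ i,
-- i.e. when (i + r) mod Q = r, and 0 otherwise. In characteristic p the binomial coefficient
-- C(j, r) with r < Q only depends on j mod Q: by Vandermonde, C(y + Q, r) = Σ_s C(Q, s) C(y, r - s),
-- and p divides C(Q, s) for 0 < s < Q. So all three identities become finite identities about
-- C(j₀, ·) with j₀ < Q: (1) is binomial inversion, Σ_s (-1)^s C(n + s, n) C(j₀, n + s) = [j₀ = n],
-- which follows from C(n + s, n) C(j₀, n + s) = C(j₀, n) C(j₀ - n, s) and Σ_s (-1)^s C(a, s) = [a = 0];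
-- (2) keeps only the term r = j₀; and (3) is C(j₀, Q - 1) = [j₀ = Q - 1].
module Submission where

open import Defs
open import Level using (Level)
open import Algebra.Bundles using (CommutativeRing)
open import Data.Nat using (ℕ; _≤_; _<_; _^_; _∸_)
open import Data.Integer using (+_)
open import Relation.Binary.PropositionalEquality using (_≡_)
open import Data.Nat.Primality using (Prime)
open import Data.Product using (_×_; proj₁)
open import Data.Sum using (_⊎_)

open import Data.Nat as ℕ using (zero; suc; z≤n; s≤s; NonZero; _<ᵇ_)
import Data.Nat.Properties as ℕ
open import Data.Nat.Combinatorics using (_C_; nCk+nC[k+1]≡[n+1]C[k+1]; k>n⇒nCk≡0; nCn≡1)
open import Data.Nat.Divisibility using (divides)
open import Data.Nat.Primality using (prime⇒nonTrivial)
open import Data.Integer as ℤ using (ℤ; -[1+_])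
import Data.Integer.Properties as ℤ
open import Data.Integer.DivMod using (_%ℕ_; _/ℕ_; a≡a%ℕn+[a/ℕn]*n; n%ℕd<d)
import Data.Integer.Tactic.RingSolver as ℤ-Solver
open import Data.Fin as Fin using (Fin; toℕ; inject₁)
open import Data.Fin.Properties using (toℕ<n; toℕ-inject₁; toℕ-fromℕ)
open import Data.Vec.Functional using (Vector)
open import Data.Bool using (Bool; true; false; if_then_else_)
open import Data.Product using (_,_; proj₂)
open import Data.Sum using (inj₁; inj₂)
open import Function using (_∘_)
open import Function.Bundles using (_⇔_)
open import Relation.Nullary using (Dec; yes; no; contradiction)
open import Relation.Nullary.Decidable using (⌊_⌋; isYes≗does; does-⇔)
open import Relation.Nullary.Reflects using (ofʸ; ofⁿ)
import Relation.Binary.PropositionalEquality as ≡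

module BinomialCoefficients where

  open import Data.Nat using (pred; _+_; _*_; _≤?_; _!)
  open import Data.Nat.Properties
  open import Data.Nat.Combinatorics using (nC1≡n; nCk≡nC[n∸k]; nCk≡n!/k![n-k]!; k![n∸k]!∣n!)
  open import Data.Nat.Divisibility
  open import Data.Nat.DivMod using (_/_; m/n*n≡m)
  open import Data.Nat.Primality using (euclidsLemma; prime⇒nonZero)
  import Data.Nat.Tactic.RingSolver as ℕ-Solver
  open import Data.Empty using (⊥-elim)
  open import Relation.Nullary using (¬_)
  open import Relation.Binary.PropositionalEquality
  open ≡-Reasoning

  nC0≡1 : ∀ n → n C 0 ≡ 1
  nC0≡1 n = trans (nCk≡nC[n∸k] {0} {n} z≤n) (nCn≡1 n)

  [1+k]*[1+n]C[1+k]≡[1+n]*nCk : ∀ n k → suc k * (suc n C suc k) ≡ suc n * (n C k)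
  [1+k]*[1+n]C[1+k]≡[1+n]*nCk zero zero = refl
  [1+k]*[1+n]C[1+k]≡[1+n]*nCk zero (suc k) = begin
    suc (suc k) * (1 C suc (suc k)) ≡⟨ cong (suc (suc k) *_) (k>n⇒nCk≡0 (s≤s (s≤s (z≤n {k})))) ⟩
    suc (suc k) * 0                 ≡⟨ *-zeroʳ (suc (suc k)) ⟩
    0                               ≡⟨ cong (1 *_) (k>n⇒nCk≡0 (s≤s (z≤n {k}))) ⟨
    1 * (0 C suc k)                 ∎
  [1+k]*[1+n]C[1+k]≡[1+n]*nCk (suc n) zero = begin
    1 * (suc (suc n) C 1) ≡⟨ *-identityˡ _ ⟩
    suc (suc n) C 1       ≡⟨ nC1≡n (suc (suc n)) ⟩
    suc (suc n)           ≡⟨ *-identityʳ _ ⟨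
    suc (suc n) * 1       ≡⟨ cong (suc (suc n) *_) (nC0≡1 (suc n)) ⟨
    suc (suc n) * (suc n C 0) ∎
  [1+k]*[1+n]C[1+k]≡[1+n]*nCk (suc n) (suc k) = begin
    suc (suc k) * (suc (suc n) C suc (suc k))
      ≡⟨ cong (suc (suc k) *_) (nCk+nC[k+1]≡[n+1]C[k+1] (suc n) (suc k)) ⟨
    suc (suc k) * (A + B)                       ≡⟨ *-distribˡ-+ (suc (suc k)) A B ⟩
    (A + suc k * A) + suc (suc k) * B
      ≡⟨ cong₂ (λ u v → (A + u) + v) ([1+k]*[1+n]C[1+k]≡[1+n]*nCk n k)
                                     ([1+k]*[1+n]C[1+k]≡[1+n]*nCk n (suc k)) ⟩
    (A + suc n * (n C k)) + suc n * (n C suc k) ≡⟨ +-assoc A _ _ ⟩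
    A + (suc n * (n C k) + suc n * (n C suc k)) ≡⟨ cong (λ t → A + t) (*-distribˡ-+ (suc n) (n C k) (n C suc k)) ⟨
    A + suc n * (n C k + n C suc k)             ≡⟨ cong (λ u → A + suc n * u) (nCk+nC[k+1]≡[n+1]C[k+1] n k) ⟩
    A + suc n * A                               ∎
    where A = suc n C suc k
          B = suc n C suc (suc k)

  p^e∣m*n∧p∤n⇒p^e∣m : ∀ {p} → Prime p → ∀ e m n → p ^ e ∣ m * n → ¬ (p ∣ n) → p ^ e ∣ m
  p^e∣m*n∧p∤n⇒p^e∣m pp zero m n _ _ = 1∣ m
  p^e∣m*n∧p∤n⇒p^e∣m {p} pp (suc e) m n p^[1+e]∣mn p∤n
    with euclidsLemma m n pp (∣-trans (m∣m*n (p ^ e)) p^[1+e]∣mn)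
  ... | inj₂ p∣n = ⊥-elim (p∤n p∣n)
  ... | inj₁ (divides m′ refl) = subst (p * p ^ e ∣_) (*-comm p m′) (*-monoʳ-∣ p p^e∣m′)
    where
    instance _ = prime⇒nonZero pp
    p*p^e∣p*m′n : p * p ^ e ∣ p * (m′ * n)
    p*p^e∣p*m′n = subst (p * p ^ e ∣_) (trans (cong (_* n) (*-comm m′ p)) (*-assoc p m′ n)) p^[1+e]∣mn
    p^e∣m′ : p ^ e ∣ m′
    p^e∣m′ = p^e∣m*n∧p∤n⇒p^e∣m pp e m′ n (*-cancelˡ-∣ p p*p^e∣p*m′n) p∤n

  p∣[p^e]Cs : ∀ {p} → Prime p → ∀ e s → 0 < s → s < p ^ e → p ∣ (p ^ e) C s
  p∣[p^e]Cs {p} pp e (suc s) _ s<p^e with p ∣? ((p ^ e) C suc s)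
  ... | yes p∣C = p∣C
  ... | no p∤C = ⊥-elim (<⇒≱ s<p^e (∣⇒≤ (p^e∣m*n∧p∤n⇒p^e∣m pp e (suc s) ((p ^ e) C suc s) p^e∣[1+s]*C p∤C)))
    where
    instance _ = m^n≢0 p e {{prime⇒nonZero pp}}
    p^e∣[1+s]*C : p ^ e ∣ suc s * ((p ^ e) C suc s)
    p^e∣[1+s]*C = subst (λ t → t ∣ suc s * (t C suc s)) (suc-pred (p ^ e))
      (divides (pred (p ^ e) C s)
        (trans ([1+k]*[1+n]C[1+k]≡[1+n]*nCk (pred (p ^ e)) s) (*-comm (suc (pred (p ^ e))) _)))

  [a+b]Ca*a!*b!≡[a+b]! : ∀ a b → ((a + b) C a) * (a ! * b !) ≡ (a + b) !
  [a+b]Ca*a!*b!≡[a+b]! a b = begin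
    ((a + b) C a) * (a ! * b !)             ≡⟨ cong (λ t → ((a + b) C a) * (a ! * t !)) (m+n∸m≡n a b) ⟨
    ((a + b) C a) * (a ! * (a + b ∸ a) !)   ≡⟨ cong (_* (a ! * (a + b ∸ a) !)) (nCk≡n!/k![n-k]! a≤a+b) ⟩
    ((a + b) ! / (a ! * (a + b ∸ a) !)) * (a ! * (a + b ∸ a) !)
                                            ≡⟨ m/n*n≡m (k![n∸k]!∣n! a≤a+b) ⟩
    (a + b) !                               ∎
    where
    a≤a+b = m≤m+n a b
    instance _ = a !* (a + b ∸ a) !≢0

  [n+s]Cn*[n+s+d]C[n+s]≡[n+s+d]Cn*[s+d]Cs : ∀ n s d →
    ((n + s) C n) * ((n + s + d) C (n + s)) ≡ ((n + s + d) C n) * ((s + d) C s)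
  [n+s]Cn*[n+s+d]C[n+s]≡[n+s+d]Cn*[s+d]Cs n s d =
    *-cancelʳ-≡ _ _ (n ! * (s ! * d !)) {{m*n≢0 (n !) (s ! * d !) {{n !≢0}} {{s !* d !≢0}}}}
      (trans lhs≡ (sym rhs≡))
    where
    x = (n + s) C n
    y = (n + s + d) C (n + s)
    u = (n + s + d) C n
    v = (s + d) C s
    regroupˡ : ∀ x y a b c → (x * y) * (a * (b * c)) ≡ y * ((x * (a * b)) * c)
    regroupˡ = ℕ-Solver.solve-∀
    regroupʳ : ∀ u v a b c → (u * v) * (a * (b * c)) ≡ u * (a * (v * (b * c)))
    regroupʳ = ℕ-Solver.solve-∀
    lhs≡ : (x * y) * (n ! * (s ! * d !)) ≡ (n + s + d) !
    lhs≡ = begin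
      (x * y) * (n ! * (s ! * d !))   ≡⟨ regroupˡ x y (n !) (s !) (d !) ⟩
      y * ((x * (n ! * s !)) * d !)   ≡⟨ cong (λ t → y * (t * d !)) ([a+b]Ca*a!*b!≡[a+b]! n s) ⟩
      y * ((n + s) ! * d !)           ≡⟨ [a+b]Ca*a!*b!≡[a+b]! (n + s) d ⟩
      (n + s + d) !                   ∎
    rhs≡ : (u * v) * (n ! * (s ! * d !)) ≡ (n + s + d) !
    rhs≡ = begin
      (u * v) * (n ! * (s ! * d !))   ≡⟨ regroupʳ u v (n !) (s !) (d !) ⟩
      u * (n ! * (v * (s ! * d !)))   ≡⟨ cong (λ t → u * (n ! * t)) ([a+b]Ca*a!*b!≡[a+b]! s d) ⟩
      u * (n ! * (s + d) !)           ≡⟨ cong (λ t → (t C n) * (n ! * (s + d) !)) (+-assoc n s d) ⟩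
      ((n + (s + d)) C n) * (n ! * (s + d) !) ≡⟨ [a+b]Ca*a!*b!≡[a+b]! n (s + d) ⟩
      (n + (s + d)) !                 ≡⟨ cong _! (+-assoc n s d) ⟨
      (n + s + d) !                   ∎

  [n+s]Cn*mC[n+s]≡mCn*[m∸n]Cs : ∀ m n s → ((n + s) C n) * (m C (n + s)) ≡ (m C n) * ((m ∸ n) C s)
  [n+s]Cn*mC[n+s]≡mCn*[m∸n]Cs m n s with n + s ≤? m
  ... | yes n+s≤m = begin
    ((n + s) C n) * (m C (n + s))          ≡⟨ cong (λ t → ((n + s) C n) * (t C (n + s))) m≡n+s+d ⟩
    ((n + s) C n) * ((n + s + d) C (n + s)) ≡⟨ [n+s]Cn*[n+s+d]C[n+s]≡[n+s+d]Cn*[s+d]Cs n s d ⟩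
    ((n + s + d) C n) * ((s + d) C s)      ≡⟨ cong₂ (λ t w → (t C n) * (w C s)) m≡n+s+d m∸n≡s+d ⟨
    (m C n) * ((m ∸ n) C s)                ∎
    where
    d = m ∸ (n + s)
    m≡n+s+d : m ≡ n + s + d
    m≡n+s+d = sym (m+[n∸m]≡n n+s≤m)
    m∸n≡s+d : m ∸ n ≡ s + d
    m∸n≡s+d = trans (cong (_∸ n) (trans m≡n+s+d (+-assoc n s d))) (m+n∸m≡n n (s + d))
  ... | no n+s≰m = begin
    ((n + s) C n) * (m C (n + s)) ≡⟨ cong (((n + s) C n) *_) (k>n⇒nCk≡0 (≰⇒> n+s≰m)) ⟩
    ((n + s) C n) * 0             ≡⟨ *-zeroʳ ((n + s) C n) ⟩
    0                             ≡⟨ mCn*[m∸n]Cs≡0 ⟨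
    (m C n) * ((m ∸ n) C s)       ∎
    where
    mCn*[m∸n]Cs≡0 : (m C n) * ((m ∸ n) C s) ≡ 0
    mCn*[m∸n]Cs≡0 with n ≤? m
    ... | yes n≤m = trans (cong ((m C n) *_) (k>n⇒nCk≡0 m∸n<s)) (*-zeroʳ (m C n))
      where
      m∸n<s : m ∸ n < s
      m∸n<s = +-cancelˡ-< n (m ∸ n) s (subst (_< n + s) (sym (m+[n∸m]≡n n≤m)) (≰⇒> n+s≰m))
    ... | no n≰m = cong (_* ((m ∸ n) C s)) (k>n⇒nCk≡0 (≰⇒> n≰m))

open BinomialCoefficients

module IntegerResidues where

  open import Data.Nat.Divisibility using (>⇒∤) renaming (_∣_ to _∣ℕ_)
  open import Data.Integer using (∣_∣; _⊖_)
  open import Data.Integer.Divisibility.Signed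
    using (_∣_; divides; ∣-refl; ∣ᵤ⇒∣; ∣⇒∣ᵤ; ∣m∣n⇒∣m+n; ∣m+n∣n⇒∣m; ∣n⇒∣m*n)
  open import Function.Bundles using (mk⇔)
  open import Relation.Binary.PropositionalEquality

  m<n∧n∣m⇒m≡0 : ∀ {m n} → m < n → n ∣ℕ m → m ≡ 0
  m<n∧n∣m⇒m≡0 {zero}  _   _   = refl
  m<n∧n∣m⇒m≡0 {suc m} m<n n∣m = contradiction n∣m (>⇒∤ m<n)

  module _ (Q : ℕ) .{{_ : NonZero Q}} where

    Q∣∣i∣⇔[i+c]%ℕQ≡c : ∀ i {c} → c < Q → Q ∣ℕ ∣ i ∣ ⇔ (i ℤ.+ + c) %ℕ Q ≡ c
    Q∣∣i∣⇔[i+c]%ℕQ≡c i {c} c<Q = mk⇔ divisible⇒residue residue⇒divisible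
      where
      r = (i ℤ.+ + c) %ℕ Q
      t = (i ℤ.+ + c) /ℕ Q
      i≡[r-c]+tQ : i ≡ (+ r ℤ.- + c) ℤ.+ t ℤ.* + Q
      i≡[r-c]+tQ = begin
        i                             ≡⟨ cancel-c i (+ c) ⟩
        (i ℤ.+ + c) ℤ.- + c           ≡⟨ cong (ℤ._- + c) (a≡a%ℕn+[a/ℕn]*n (i ℤ.+ + c) Q) ⟩
        (+ r ℤ.+ t ℤ.* + Q) ℤ.- + c   ≡⟨ regroup (+ r) (t ℤ.* + Q) (+ c) ⟩
        (+ r ℤ.- + c) ℤ.+ t ℤ.* + Q   ∎
        where
        open ≡-Reasoning
        cancel-c : ∀ x y → x ≡ (x ℤ.+ y) ℤ.- y
        cancel-c = ℤ-Solver.solve-∀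
        regroup : ∀ x y z → (x ℤ.+ y) ℤ.- z ≡ (x ℤ.- z) ℤ.+ y
        regroup = ℤ-Solver.solve-∀
      Q∣tQ : + Q ∣ t ℤ.* + Q
      Q∣tQ = ∣n⇒∣m*n t ∣-refl
      ∣r⊖c∣<Q : ∣ r ⊖ c ∣ < Q
      ∣r⊖c∣<Q = ℕ.≤-<-trans (ℤ.∣m⊝n∣≤m⊔n r c) (ℕ.⊔-lub (n%ℕd<d (i ℤ.+ + c) Q) c<Q)
      divisible⇒residue : Q ∣ℕ ∣ i ∣ → r ≡ c
      divisible⇒residue Q∣i = ℤ.+-injective (ℤ.i-j≡0⇒i≡j (+ r) (+ c) r-c≡0)
        where
        Q∣r-c : + Q ∣ + r ℤ.- + c
        Q∣r-c = ∣m+n∣n⇒∣m (subst (+ Q ∣_) i≡[r-c]+tQ (∣ᵤ⇒∣ Q∣i)) Q∣tQ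
        r-c≡0 : + r ℤ.- + c ≡ + 0
        r-c≡0 = ℤ.∣i∣≡0⇒i≡0 (m<n∧n∣m⇒m≡0 ∣r-c∣<Q (∣⇒∣ᵤ Q∣r-c))
          where ∣r-c∣<Q = subst (λ x → ∣ x ∣ < Q) (sym (ℤ.m-n≡m⊖n r c)) ∣r⊖c∣<Q
      residue⇒divisible : r ≡ c → Q ∣ℕ ∣ i ∣
      residue⇒divisible r≡c = ∣⇒∣ᵤ (divides t (begin
        i                             ≡⟨ i≡[r-c]+tQ ⟩
        (+ r ℤ.- + c) ℤ.+ t ℤ.* + Q   ≡⟨ cong (λ x → (+ x ℤ.- + c) ℤ.+ t ℤ.* + Q) r≡c ⟩
        (+ c ℤ.- + c) ℤ.+ t ℤ.* + Q   ≡⟨ cong (ℤ._+ t ℤ.* + Q) (ℤ.+-inverseʳ (+ c)) ⟩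
        + 0 ℤ.+ t ℤ.* + Q             ≡⟨ ℤ.+-identityˡ (t ℤ.* + Q) ⟩
        t ℤ.* + Q                     ∎))
        where open ≡-Reasoning

open IntegerResidues

module BaseDigits where

  open import Data.Nat.Properties
  open import Relation.Binary.PropositionalEquality

  -- For k ≥ 1 this is q^(k-1) ≤ r; for k = 0 it is vacuous, covering the case (n, k) = (0, 0).
  AtLeastDigits : ℕ → ℕ → ℕ → Set
  AtLeastDigits q k r = ∀ m → m < k → q ^ m ≤ r

  AtLeastDigits-mono : ∀ {q k n r} → AtLeastDigits q k n → n ≤ r → AtLeastDigits q k r
  AtLeastDigits-mono lower n≤r m m<k = ≤-trans (lower m m<k) n≤r

  n<m^n : ∀ {m} → 1 < m → ∀ n → n < m ^ n
  n<m^n 1<m zero    = s≤s z≤n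
  n<m^n {m} 1<m (suc n) = ≤-<-trans (n<m^n 1<m n) (^-monoʳ-< m 1<m (n<1+n n))

  module _ (q r k : ℕ) (lower : AtLeastDigits q k r) (upper : r < q ^ k) where

    digitsSearch≡ : ∀ fuel k′ → k′ ≤ k → k ∸ k′ < fuel → digitsSearch q r fuel k′ ≡ k
    digitsSearch≡ (suc fuel) k′ k′≤k k∸k′<1+fuel with r <ᵇ q ^ k′ | <ᵇ-reflects-< r (q ^ k′)
    ... | true  | ofʸ r<q^k′ = ≤-antisym k′≤k (≮⇒≥ (λ k′<k → <⇒≱ r<q^k′ (lower k′ k′<k)))
    ... | false | ofⁿ r≮q^k′ = digitsSearch≡ fuel (suc k′) k′<k k∸1+k′<fuel
      where
      k′<k : k′ < k
      k′<k = ≤∧≢⇒< k′≤k (λ k′≡k → r≮q^k′ (subst (λ x → r < q ^ x) (sym k′≡k) upper))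
      k∸1+k′<fuel : k ∸ suc k′ < fuel
      k∸1+k′<fuel = ≤-pred (subst (_< suc fuel) (+-∸-assoc 1 k′<k) k∸k′<1+fuel)

  AtLeastDigits⇒k≤r : ∀ {q r} k → 1 < q → AtLeastDigits q k r → k ≤ r
  AtLeastDigits⇒k≤r zero    _   _     = z≤n
  AtLeastDigits⇒k≤r (suc k) 1<q lower = <-≤-trans (n<m^n 1<q k) (lower k (n<1+n k))

  numDigits≡ : ∀ {q r k} → 1 < q → AtLeastDigits q k r → r < q ^ k → numDigits q r ≡ k
  numDigits≡ {q} {r} {k} 1<q lower upper =
    digitsSearch≡ q r k lower upper (suc r) 0 z≤n (s≤s (AtLeastDigits⇒k≤r k 1<q lower))

open BaseDigits

x+[y+z]≡[x+z]+y : ∀ x y z → x ℤ.+ (y ℤ.+ z) ≡ (x ℤ.+ z) ℤ.+ y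
x+[y+z]≡[x+z]+y = ℤ-Solver.solve-∀

⌊⌋-⇔ : ∀ {a b} {A : Set a} {B : Set b} → A ⇔ B → (a? : Dec A) (b? : Dec B) → ⌊ a? ⌋ ≡ ⌊ b? ⌋
⌊⌋-⇔ A⇔B a? b? = ≡.trans (isYes≗does a?) (≡.trans (does-⇔ A⇔B a? b?) (≡.sym (isYes≗does b?)))

module _ {c ℓ : Level} (K : CommutativeRing c ℓ) where

  open CommutativeRing K
  open import Algebra.Properties.Ring ring using (-1*x≈-x; -‿distribˡ-*; -‿involutive; -0#≈0#)
  open import Algebra.Properties.Semiring.Mult semiring using (×-homo-+; ×1-homo-*) renaming (_×_ to _×ᵣ_)
  open import Algebra.Properties.Semiring.Sum semiring
    using ( sum; sum-syntax; sum-cong-≋; sum-cong-≗; sum-replicate-zero; sum-init-last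
          ; ∑-distrib-+; *-distribˡ-sum; *-distribʳ-sum)
  open import Relation.Binary.Reasoning.Setoid setoid

  fromℕ≡×1# : ∀ m → fromℕ K m ≡ m ×ᵣ 1#
  fromℕ≡×1# zero    = ≡.refl
  fromℕ≡×1# (suc m) = ≡.cong (λ x → 1# + x) (fromℕ≡×1# m)

  fromℕ-homo-+ : ∀ m n → fromℕ K (m ℕ.+ n) ≈ fromℕ K m + fromℕ K n
  fromℕ-homo-+ m n rewrite fromℕ≡×1# (m ℕ.+ n) | fromℕ≡×1# m | fromℕ≡×1# n = ×-homo-+ 1# m n

  fromℕ-homo-* : ∀ m n → fromℕ K (m ℕ.* n) ≈ fromℕ K m * fromℕ K n
  fromℕ-homo-* m n rewrite fromℕ≡×1# (m ℕ.* n) | fromℕ≡×1# m | fromℕ≡×1# n = ×1-homo-* m n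

  fromℕ-1 : fromℕ K 1 ≈ 1#
  fromℕ-1 = +-identityʳ 1#

  fromℤ-neg : ∀ z → fromℤ K (ℤ.- z) ≈ - fromℤ K z
  fromℤ-neg (+ zero)  = sym (-0#≈0#)
  fromℤ-neg (+ suc m) = refl
  fromℤ-neg -[1+ m ]  = sym (-‿involutive _)

  sgn : ℕ → Carrier
  sgn = pow K (- 1#)

  binomᴷ : ℤ → ℕ → Carrier
  binomᴷ y r = fromℤ K (binomℤ y r)

  binomᴷ-neg : ∀ m r → binomᴷ -[1+ m ] r ≈ sgn r * fromℕ K ((m ℕ.+ r) C r)
  binomᴷ-neg m r = fromℤ-sign r ((m ℕ.+ r) C r)
    where
    fromℤ-sign : ∀ r c → fromℤ K ((ℤ.- + 1) ℤ.^ r ℤ.* + c) ≈ sgn r * fromℕ K c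
    fromℤ-sign zero    c = begin
      fromℤ K (ℤ.+ 1 ℤ.* + c) ≡⟨ ≡.cong (fromℤ K) (ℤ.*-identityˡ (+ c)) ⟩
      fromℕ K c               ≈⟨ *-identityˡ (fromℕ K c) ⟨
      1# * fromℕ K c          ∎
    fromℤ-sign (suc r) c = begin
      fromℤ K ((ℤ.- + 1) ℤ.* (ℤ.- + 1) ℤ.^ r ℤ.* + c)
        ≡⟨ ≡.cong (fromℤ K) (≡.trans (ℤ.*-assoc (ℤ.- + 1) ((ℤ.- + 1) ℤ.^ r) (+ c))
                                     (ℤ.-1*i≡-i ((ℤ.- + 1) ℤ.^ r ℤ.* + c))) ⟩
      fromℤ K (ℤ.- ((ℤ.- + 1) ℤ.^ r ℤ.* + c)) ≈⟨ fromℤ-neg ((ℤ.- + 1) ℤ.^ r ℤ.* + c) ⟩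
      - fromℤ K ((ℤ.- + 1) ℤ.^ r ℤ.* + c)     ≈⟨ -‿cong (fromℤ-sign r c) ⟩
      - (sgn r * fromℕ K c)                    ≈⟨ -‿distribˡ-* _ _ ⟩
      - sgn r * fromℕ K c                      ≈⟨ *-congʳ (-1*x≈-x (sgn r)) ⟨
      sgn (suc r) * fromℕ K c                  ∎

  [-s]f+sf≈0 : ∀ s f → (- 1# * s) * f + s * f ≈ 0#
  [-s]f+sf≈0 s f = begin
    (- 1# * s) * f + s * f ≈⟨ +-congʳ (*-congʳ (-1*x≈-x s)) ⟩
    - s * f + s * f        ≈⟨ +-congʳ (-‿distribˡ-* s f) ⟨
    - (s * f) + s * f      ≈⟨ -‿inverseˡ (s * f) ⟩
    0#                     ∎

  [-s][a+b]+sa≈[-s]b : ∀ s a b → (- 1# * s) * (a + b) + s * a ≈ (- 1# * s) * b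
  [-s][a+b]+sa≈[-s]b s a b = begin
    (- 1# * s) * (a + b) + s * a               ≈⟨ +-congʳ (distribˡ (- 1# * s) a b) ⟩
    ((- 1# * s) * a + (- 1# * s) * b) + s * a  ≈⟨ +-congʳ (+-comm _ _) ⟩
    ((- 1# * s) * b + (- 1# * s) * a) + s * a  ≈⟨ +-assoc _ _ _ ⟩
    (- 1# * s) * b + ((- 1# * s) * a + s * a)  ≈⟨ +-congˡ ([-s]f+sf≈0 s a) ⟩
    (- 1# * s) * b + 0#                        ≈⟨ +-identityʳ _ ⟩
    (- 1# * s) * b                             ∎

  binomᴷ-pascal : ∀ y r → binomᴷ (y ℤ.+ + 1) (suc r) ≈ binomᴷ y (suc r) + binomᴷ y r
  binomᴷ-pascal (+ m) r = begin
    fromℕ K ((m ℕ.+ 1) C suc r)           ≡⟨ ≡.cong (λ t → fromℕ K (t C suc r)) (ℕ.+-comm m 1) ⟩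
    fromℕ K (suc m C suc r)               ≡⟨ ≡.cong (fromℕ K) (nCk+nC[k+1]≡[n+1]C[k+1] m r) ⟨
    fromℕ K (m C r ℕ.+ m C suc r)         ≈⟨ fromℕ-homo-+ (m C r) (m C suc r) ⟩
    fromℕ K (m C r) + fromℕ K (m C suc r) ≈⟨ +-comm _ _ ⟩
    fromℕ K (m C suc r) + fromℕ K (m C r) ∎
  binomᴷ-pascal -[1+ zero ] r = begin
    fromℕ K (0 C suc r)                            ≡⟨ ≡.cong (fromℕ K) (k>n⇒nCk≡0 (s≤s (z≤n {r}))) ⟩
    0#                                             ≈⟨ [-s]f+sf≈0 (sgn r) (fromℕ K 1) ⟨
    sgn (suc r) * fromℕ K 1 + sgn r * fromℕ K 1
      ≡⟨ ≡.cong₂ (λ u v → sgn (suc r) * fromℕ K u + sgn r * fromℕ K v) (nCn≡1 (suc r)) (nCn≡1 r) ⟨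
    sgn (suc r) * fromℕ K (suc r C suc r) + sgn r * fromℕ K (r C r)
      ≈⟨ +-cong (binomᴷ-neg 0 (suc r)) (binomᴷ-neg 0 r) ⟨
    binomᴷ -[1+ 0 ] (suc r) + binomᴷ -[1+ 0 ] r    ∎
  binomᴷ-pascal -[1+ suc m ] r = begin
    binomᴷ -[1+ m ] (suc r)                        ≈⟨ binomᴷ-neg m (suc r) ⟩
    sgn (suc r) * fromℕ K (N C suc r)              ≈⟨ [-s][a+b]+sa≈[-s]b (sgn r) (fromℕ K (N C r)) (fromℕ K (N C suc r)) ⟨
    sgn (suc r) * (fromℕ K (N C r) + fromℕ K (N C suc r)) + sgn r * fromℕ K (N C r)
      ≈⟨ +-congʳ (*-congˡ (fromℕ-homo-+ (N C r) (N C suc r))) ⟨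
    sgn (suc r) * fromℕ K (N C r ℕ.+ N C suc r) + sgn r * fromℕ K (N C r)
      ≡⟨ ≡.cong₂ (λ u v → sgn (suc r) * fromℕ K u + sgn r * fromℕ K (v C r))
                 (nCk+nC[k+1]≡[n+1]C[k+1] N r) (ℕ.+-suc m r) ⟩
    sgn (suc r) * fromℕ K (suc N C suc r) + sgn r * fromℕ K (suc (m ℕ.+ r) C r)
      ≈⟨ +-cong (binomᴷ-neg (suc m) (suc r)) (binomᴷ-neg (suc m) r) ⟨
    binomᴷ -[1+ suc m ] (suc r) + binomᴷ -[1+ suc m ] r ∎
    where N = m ℕ.+ suc r

  binomᴷ-0 : ∀ y → binomᴷ y 0 ≈ 1#
  binomᴷ-0 (+ m) = trans (reflexive (≡.cong (fromℕ K) (nC0≡1 m))) fromℕ-1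
  binomᴷ-0 -[1+ m ] = begin
    binomᴷ -[1+ m ] 0                ≈⟨ binomᴷ-neg m 0 ⟩
    1# * fromℕ K ((m ℕ.+ 0) C 0)     ≈⟨ *-identityˡ _ ⟩
    fromℕ K ((m ℕ.+ 0) C 0)          ≡⟨ ≡.cong (fromℕ K) (nC0≡1 (m ℕ.+ 0)) ⟩
    fromℕ K 1                        ≈⟨ fromℕ-1 ⟩
    1#                               ∎

  ∑-zero : ∀ {n} (f : Vector Carrier n) → (∀ i → f i ≈ 0#) → sum f ≈ 0#
  ∑-zero {n} f f≈0 = trans (sum-cong-≋ f≈0) (sum-replicate-zero n)

  binomᴷ-vandermonde : ∀ m y r →
    binomᴷ (y ℤ.+ + m) r ≈ ∑[ s < suc r ] (fromℕ K (m C toℕ s) * binomᴷ y (r ℕ.∸ toℕ s))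
  binomᴷ-vandermonde zero y r = begin
    binomᴷ (y ℤ.+ + 0) r                      ≡⟨ ≡.cong (λ t → binomᴷ t r) (ℤ.+-identityʳ y) ⟩
    binomᴷ y r                                ≈⟨ *-identityˡ (binomᴷ y r) ⟨
    1# * binomᴷ y r                           ≈⟨ +-identityʳ _ ⟨
    1# * binomᴷ y r + 0#                      ≈⟨ +-cong (*-congʳ fromℕ-1) (∑-zero _ 0Cs*b≈0) ⟨
    fromℕ K 1 * binomᴷ y r + ∑[ s < r ] (fromℕ K (0 C suc (toℕ s)) * binomᴷ y (r ℕ.∸ suc (toℕ s))) ∎
    where
    0Cs*b≈0 : ∀ s → fromℕ K (0 C suc (toℕ {r} s)) * binomᴷ y (r ℕ.∸ suc (toℕ s)) ≈ 0#
    0Cs*b≈0 s = trans (*-congʳ (reflexive (≡.cong (fromℕ K) (k>n⇒nCk≡0 (s≤s (z≤n {toℕ s})))))) (zeroˡ _)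
  binomᴷ-vandermonde (suc m) y zero = begin
    binomᴷ (y ℤ.+ + suc m) 0            ≈⟨ binomᴷ-0 (y ℤ.+ + suc m) ⟩
    1#                                  ≈⟨ binomᴷ-0 y ⟨
    binomᴷ y 0                          ≈⟨ *-identityˡ _ ⟨
    1# * binomᴷ y 0                     ≈⟨ *-congʳ (trans (reflexive (≡.cong (fromℕ K) (nC0≡1 (suc m)))) fromℕ-1) ⟨
    fromℕ K (suc m C 0) * binomᴷ y 0    ≈⟨ +-identityʳ _ ⟨
    fromℕ K (suc m C 0) * binomᴷ y 0 + 0# ∎
  binomᴷ-vandermonde (suc m) y (suc r) = begin
    binomᴷ (y ℤ.+ + suc m) (suc r)               ≡⟨ ≡.cong (λ t → binomᴷ t (suc r)) y+[1+m]≡[y+m]+1 ⟩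
    binomᴷ ((y ℤ.+ + m) ℤ.+ + 1) (suc r)         ≈⟨ binomᴷ-pascal (y ℤ.+ + m) r ⟩
    binomᴷ (y ℤ.+ + m) (suc r) + binomᴷ (y ℤ.+ + m) r
                                                 ≈⟨ +-cong (binomᴷ-vandermonde m y (suc r)) (binomᴷ-vandermonde m y r) ⟩
    (first + ∑[ s < suc r ] g s) + ∑[ s < suc r ] f s ≈⟨ +-assoc _ _ _ ⟩
    first + (∑[ s < suc r ] g s + ∑[ s < suc r ] f s) ≈⟨ +-congˡ (∑-distrib-+ g f) ⟨
    first + ∑[ s < suc r ] (g s + f s)           ≈⟨ +-cong first≈ (sum-cong-≋ pascal-term) ⟩
    fromℕ K (suc m C 0) * binomᴷ y (suc r) + ∑[ s < suc r ] (fromℕ K (suc m C suc (toℕ s)) * b s) ∎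
    where
    b : Vector Carrier (suc r)
    b s = binomᴷ y (r ℕ.∸ toℕ s)
    f g : Vector Carrier (suc r)
    f s = fromℕ K (m C toℕ s) * b s
    g s = fromℕ K (m C suc (toℕ s)) * b s
    first = fromℕ K (m C 0) * binomᴷ y (suc r)
    y+[1+m]≡[y+m]+1 : y ℤ.+ + suc m ≡ (y ℤ.+ + m) ℤ.+ + 1
    y+[1+m]≡[y+m]+1 = ≡.trans (≡.cong (λ t → y ℤ.+ t) (ℤ.pos-+ 1 m)) (x+[y+z]≡[x+z]+y y (+ 1) (+ m))
    first≈ : first ≈ fromℕ K (suc m C 0) * binomᴷ y (suc r)
    first≈ = reflexive (≡.cong (λ t → fromℕ K t * binomᴷ y (suc r)) (≡.trans (nC0≡1 m) (≡.sym (nC0≡1 (suc m)))))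
    pascal-term : ∀ s → g s + f s ≈ fromℕ K (suc m C suc (toℕ s)) * b s
    pascal-term s = begin
      g s + f s                                      ≈⟨ distribʳ (b s) _ _ ⟨
      (fromℕ K (m C suc i) + fromℕ K (m C i)) * b s  ≈⟨ *-congʳ (+-comm _ _) ⟩
      (fromℕ K (m C i) + fromℕ K (m C suc i)) * b s  ≈⟨ *-congʳ (fromℕ-homo-+ (m C i) (m C suc i)) ⟨
      fromℕ K (m C i ℕ.+ m C suc i) * b s            ≡⟨ ≡.cong (λ t → fromℕ K t * b s) (nCk+nC[k+1]≡[n+1]C[k+1] m i) ⟩
      fromℕ K (suc m C suc i) * b s                  ∎
      where i = toℕ s

  BinomialsPeriodic : ℕ → Set ℓ
  BinomialsPeriodic Q = ∀ r → r ℕ.< Q → ∀ y → binomᴷ (y ℤ.+ + Q) r ≈ binomᴷ y r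

  module _ {p : ℕ} (p-prime : Prime p) (char-p : HasCharacteristic K p) where

    fromℕ-[p^e]Cs≈0 : ∀ e s → 0 ℕ.< s → s ℕ.< p ℕ.^ e → fromℕ K ((p ℕ.^ e) C s) ≈ 0#
    fromℕ-[p^e]Cs≈0 e s 0<s s<p^e with p∣[p^e]Cs p-prime e s 0<s s<p^e
    ... | divides d eq = begin
      fromℕ K ((p ℕ.^ e) C s)  ≡⟨ ≡.cong (fromℕ K) eq ⟩
      fromℕ K (d ℕ.* p)        ≈⟨ fromℕ-homo-* d p ⟩
      fromℕ K d * fromℕ K p    ≈⟨ *-congˡ char-p ⟩
      fromℕ K d * 0#           ≈⟨ zeroʳ _ ⟩
      0#                       ∎

    binomᴷ-periodic-p^e : ∀ e → BinomialsPeriodic (p ℕ.^ e)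
    binomᴷ-periodic-p^e e r r<p^e y = begin
      binomᴷ (y ℤ.+ + (p ℕ.^ e)) r ≈⟨ binomᴷ-vandermonde (p ℕ.^ e) y r ⟩
      fromℕ K ((p ℕ.^ e) C 0) * binomᴷ y r
        + ∑[ s < r ] (fromℕ K ((p ℕ.^ e) C suc (toℕ s)) * binomᴷ y (r ℕ.∸ suc (toℕ s)))
        ≈⟨ +-cong (*-congʳ (trans (reflexive (≡.cong (fromℕ K) (nC0≡1 (p ℕ.^ e)))) fromℕ-1))
                  (∑-zero _ higher-terms≈0) ⟩
      1# * binomᴷ y r + 0#         ≈⟨ +-identityʳ _ ⟩
      1# * binomᴷ y r              ≈⟨ *-identityˡ _ ⟩
      binomᴷ y r                   ∎
      where
      higher-terms≈0 : ∀ s → fromℕ K ((p ℕ.^ e) C suc (toℕ {r} s)) * binomᴷ y (r ℕ.∸ suc (toℕ s)) ≈ 0#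
      higher-terms≈0 s =
        trans (*-congʳ (fromℕ-[p^e]Cs≈0 e (suc (toℕ s)) (s≤s z≤n) (ℕ.≤-<-trans (toℕ<n s) r<p^e))) (zeroˡ _)

  module _ (Q : ℕ) .{{_ : ℕ.NonZero Q}} where

    periodic⇒periodic-multiples : (f : ℤ → Carrier) → (∀ y → f (y ℤ.+ + Q) ≈ f y) →
                                  ∀ y t → f (y ℤ.+ t ℤ.* + Q) ≈ f y
    periodic⇒periodic-multiples f periodic y (+ u) =
      trans (reflexive (≡.cong (λ t → f (y ℤ.+ t)) (≡.sym (ℤ.pos-* u Q)))) (periodic-ℕ-multiples u y)
      where
      periodic-ℕ-multiples : ∀ u y → f (y ℤ.+ + (u ℕ.* Q)) ≈ f y
      periodic-ℕ-multiples zero    y = reflexive (≡.cong f (ℤ.+-identityʳ y))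
      periodic-ℕ-multiples (suc u) y = begin
        f (y ℤ.+ + (Q ℕ.+ u ℕ.* Q))         ≡⟨ ≡.cong f (x+[y+z]≡[x+z]+y y (+ Q) (+ (u ℕ.* Q))) ⟩
        f ((y ℤ.+ + (u ℕ.* Q)) ℤ.+ + Q)     ≈⟨ periodic (y ℤ.+ + (u ℕ.* Q)) ⟩
        f (y ℤ.+ + (u ℕ.* Q))               ≈⟨ periodic-ℕ-multiples u y ⟩
        f y                                 ∎
    periodic⇒periodic-multiples f periodic y -[1+ u ] = sym (begin
      f y                                       ≡⟨ ≡.cong f (cancel y (+ Q) (+ suc u)) ⟨
      f ((y ℤ.+ -[1+ u ] ℤ.* + Q) ℤ.+ + suc u ℤ.* + Q) ≈⟨ periodic⇒periodic-multiples f periodic _ (+ suc u) ⟩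
      f (y ℤ.+ -[1+ u ] ℤ.* + Q)                ∎)
      where
      cancel : ∀ y q s → (y ℤ.+ (ℤ.- s) ℤ.* q) ℤ.+ s ℤ.* q ≡ y
      cancel = ℤ-Solver.solve-∀

    binomᴷ-reduce : BinomialsPeriodic Q → ∀ {r} → r ℕ.< Q → ∀ j → binomᴷ j r ≈ fromℕ K ((j %ℕ Q) C r)
    binomᴷ-reduce periodic {r} r<Q j = begin
      binomᴷ j r                                      ≡⟨ ≡.cong (λ t → binomᴷ t r) (a≡a%ℕn+[a/ℕn]*n j Q) ⟩
      binomᴷ (+ (j %ℕ Q) ℤ.+ (j /ℕ Q) ℤ.* + Q) r
        ≈⟨ periodic⇒periodic-multiples (λ y → binomᴷ y r) (periodic r r<Q) (+ (j %ℕ Q)) (j /ℕ Q) ⟩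
      fromℕ K ((j %ℕ Q) C r)                          ∎

  𝟙 : Bool → Carrier
  𝟙 b = if b then 1# else 0#

  if≈𝟙* : ∀ b x → (if b then x else 0#) ≈ 𝟙 b * x
  if≈𝟙* true  x = sym (*-identityˡ x)
  if≈𝟙* false x = sym (zeroˡ x)

  ∑-snoc : ∀ L (f : ℕ → Carrier) → ∑[ s < suc L ] f (toℕ s) ≈ ∑[ s < L ] f (toℕ s) + f L
  ∑-snoc L f = begin
    ∑[ s < suc L ] f (toℕ s)                          ≈⟨ sum-init-last (λ s → f (toℕ s)) ⟩
    ∑[ s < L ] f (toℕ (inject₁ s)) + f (toℕ (Fin.fromℕ L))
      ≈⟨ +-cong (reflexive (sum-cong-≗ {L} (λ s → ≡.cong f (toℕ-inject₁ s)))) (reflexive (≡.cong f (toℕ-fromℕ L))) ⟩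
    ∑[ s < L ] f (toℕ s) + f L                        ∎

  ∑𝟙-miss : ∀ {m n} L → m ℕ.< n → ∑[ s < L ] 𝟙 ⌊ m ℕ.≟ n ℕ.+ toℕ s ⌋ ≈ 0#
  ∑𝟙-miss {m} {n} L m<n = ∑-zero {L} _ (λ s → 𝟙≈0 (m ℕ.≟ n ℕ.+ toℕ s))
    where
    𝟙≈0 : ∀ {t} (m≟t : Dec (m ≡ n ℕ.+ t)) → 𝟙 ⌊ m≟t ⌋ ≈ 0#
    𝟙≈0 (yes m≡n+t) = contradiction (≡.subst (n ℕ.≤_) (≡.sym m≡n+t) (ℕ.m≤m+n n _)) (ℕ.<⇒≱ m<n)
    𝟙≈0 (no _) = refl

  ∑𝟙-hit : ∀ {m n} L → n ℕ.≤ m → m ℕ.< n ℕ.+ L → ∑[ s < L ] 𝟙 ⌊ m ℕ.≟ n ℕ.+ toℕ s ⌋ ≈ 1#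
  ∑𝟙-hit {m} {n} zero n≤m m<n+0 = contradiction (≡.subst (m ℕ.<_) (ℕ.+-identityʳ n) m<n+0) (ℕ.≤⇒≯ n≤m)
  ∑𝟙-hit {m} {n} (suc L) n≤m m<n+1+L = begin
    𝟙 ⌊ m ℕ.≟ n ℕ.+ 0 ⌋ + ∑[ s < L ] 𝟙 ⌊ m ℕ.≟ n ℕ.+ suc (toℕ s) ⌋
      ≡⟨ ≡.cong₂ (λ a b → 𝟙 ⌊ m ℕ.≟ a ⌋ + b) (ℕ.+-identityʳ n)
                 (sum-cong-≗ {L} (λ s → ≡.cong (λ t → 𝟙 ⌊ m ℕ.≟ t ⌋) (ℕ.+-suc n (toℕ s)))) ⟩
    𝟙 ⌊ m ℕ.≟ n ⌋ + ∑[ s < L ] 𝟙 ⌊ m ℕ.≟ suc n ℕ.+ toℕ s ⌋ ≈⟨ split (m ℕ.≟ n) ⟩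
    1#                                                     ∎
    where
    split : (m≟n : Dec (m ≡ n)) → 𝟙 ⌊ m≟n ⌋ + ∑[ s < L ] 𝟙 ⌊ m ℕ.≟ suc n ℕ.+ toℕ s ⌋ ≈ 1#
    split (yes ≡.refl) = trans (+-congˡ (∑𝟙-miss L (ℕ.n<1+n n))) (+-identityʳ 1#)
    split (no m≢n)     = trans (+-identityˡ _)
      (∑𝟙-hit L (ℕ.≤∧≢⇒< n≤m (m≢n ∘ ≡.sym)) (≡.subst (m ℕ.<_) (ℕ.+-suc n L) m<n+1+L))

  ∑-selection : ∀ m n L → m ℕ.< n ℕ.+ L →
    ∑[ s < L ] (fromℕ K ((n ℕ.+ toℕ s) C n) * 𝟙 ⌊ m ℕ.≟ n ℕ.+ toℕ s ⌋) ≈ fromℕ K (m C n)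
  ∑-selection m n L m<n+L = begin
    ∑[ s < L ] (fromℕ K ((n ℕ.+ toℕ s) C n) * 𝟙 ⌊ m ℕ.≟ n ℕ.+ toℕ s ⌋)
      ≈⟨ sum-cong-≋ {L} (λ s → C-on-diagonal (m ℕ.≟ n ℕ.+ toℕ s)) ⟩
    ∑[ s < L ] (fromℕ K (m C n) * 𝟙 ⌊ m ℕ.≟ n ℕ.+ toℕ s ⌋)
      ≈⟨ *-distribˡ-sum {L} (fromℕ K (m C n)) _ ⟨
    fromℕ K (m C n) * hits
      ≈⟨ count (n ℕ.≤? m) ⟩
    fromℕ K (m C n) ∎
    where
    C-on-diagonal : ∀ {t} (m≟n+t : Dec (m ≡ n ℕ.+ t)) →
      fromℕ K ((n ℕ.+ t) C n) * 𝟙 ⌊ m≟n+t ⌋ ≈ fromℕ K (m C n) * 𝟙 ⌊ m≟n+t ⌋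
    C-on-diagonal (yes m≡n+t) = reflexive (≡.cong (λ u → fromℕ K (u C n) * 1#) (≡.sym m≡n+t))
    C-on-diagonal (no _)      = trans (zeroʳ _) (sym (zeroʳ _))
    hits = ∑[ s < L ] 𝟙 ⌊ m ℕ.≟ n ℕ.+ toℕ s ⌋
    count : Dec (n ℕ.≤ m) → fromℕ K (m C n) * hits ≈ fromℕ K (m C n)
    count (yes n≤m) = trans (*-congˡ (∑𝟙-hit L n≤m m<n+L)) (*-identityʳ _)
    count (no n≰m)  = begin
      fromℕ K (m C n) * hits ≡⟨ ≡.cong (λ u → fromℕ K u * hits) mCn≡0 ⟩
      0# * hits              ≈⟨ zeroˡ hits ⟩
      0#                     ≡⟨ ≡.cong (fromℕ K) mCn≡0 ⟨
      fromℕ K (m C n)        ∎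
      where mCn≡0 = k>n⇒nCk≡0 (ℕ.≰⇒> n≰m)

  ∑±C : ℕ → ℕ → Carrier
  ∑±C a L = ∑[ s < L ] (sgn (toℕ s) * fromℕ K (a C toℕ s))

  ∑±C-0 : ∀ {L} → 0 ℕ.< L → ∑±C 0 L ≈ 1#
  ∑±C-0 {suc L} _ = begin
    1# * fromℕ K 1 + ∑[ s < L ] (sgn (suc (toℕ s)) * fromℕ K (0 C suc (toℕ s)))
                     ≈⟨ +-cong (*-identityˡ _) (∑-zero {L} _ higher-terms≈0) ⟩
    fromℕ K 1 + 0#   ≈⟨ +-identityʳ _ ⟩
    fromℕ K 1        ≈⟨ fromℕ-1 ⟩
    1#               ∎
    where
    higher-terms≈0 : ∀ (s : Fin L) → sgn (suc (toℕ s)) * fromℕ K (0 C suc (toℕ s)) ≈ 0#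
    higher-terms≈0 s = trans (*-congˡ (reflexive (≡.cong (fromℕ K) (k>n⇒nCk≡0 (s≤s (z≤n {toℕ s})))))) (zeroʳ _)

  ∑±C-pascal : ∀ a L → ∑±C (suc a) (suc L) ≈ ∑±C a (suc L) - ∑±C a L
  ∑±C-pascal a L = begin
    sgn 0 * fromℕ K (suc a C 0) + ∑[ s < L ] (sgn (suc (toℕ s)) * fromℕ K (suc a C suc (toℕ s)))
      ≈⟨ +-cong first-terms (sum-cong-≋ {L} split) ⟩
    sgn 0 * fromℕ K (a C 0)
      + ∑[ s < L ] (- 1# * (sgn (toℕ s) * fromℕ K (a C toℕ s)) + sgn (suc (toℕ s)) * fromℕ K (a C suc (toℕ s)))
      ≈⟨ +-congˡ (∑-distrib-+ {L} _ _) ⟩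
    sgn 0 * fromℕ K (a C 0) + (∑[ s < L ] (- 1# * (sgn (toℕ s) * fromℕ K (a C toℕ s))) + T)
      ≈⟨ +-congˡ (+-congʳ (sym (*-distribˡ-sum {L} (- 1#) _))) ⟩
    sgn 0 * fromℕ K (a C 0) + (- 1# * ∑±C a L + T)
      ≈⟨ +-congˡ (+-congʳ (-1*x≈-x _)) ⟩
    sgn 0 * fromℕ K (a C 0) + (- ∑±C a L + T)
      ≈⟨ x∙yz≈xz∙y _ _ _ ⟩
    ∑±C a (suc L) - ∑±C a L ∎
    where
    open import Algebra.Properties.CommutativeSemigroup +-commutativeSemigroup using (x∙yz≈xz∙y)
    T = ∑[ s < L ] (sgn (suc (toℕ s)) * fromℕ K (a C suc (toℕ s)))
    first-terms : sgn 0 * fromℕ K (suc a C 0) ≈ sgn 0 * fromℕ K (a C 0)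
    first-terms = reflexive (≡.cong (λ u → sgn 0 * fromℕ K u) (≡.trans (nC0≡1 (suc a)) (≡.sym (nC0≡1 a))))
    split : ∀ s → sgn (suc (toℕ s)) * fromℕ K (suc a C suc (toℕ s))
                  ≈ - 1# * (sgn (toℕ s) * fromℕ K (a C toℕ s)) + sgn (suc (toℕ s)) * fromℕ K (a C suc (toℕ s))
    split s = begin
      sgn (suc i) * fromℕ K (suc a C suc i)
        ≡⟨ ≡.cong (λ u → sgn (suc i) * fromℕ K u) (nCk+nC[k+1]≡[n+1]C[k+1] a i) ⟨
      sgn (suc i) * fromℕ K (a C i ℕ.+ a C suc i)                        ≈⟨ *-congˡ (fromℕ-homo-+ (a C i) (a C suc i)) ⟩
      sgn (suc i) * (fromℕ K (a C i) + fromℕ K (a C suc i))              ≈⟨ distribˡ _ _ _ ⟩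
      sgn (suc i) * fromℕ K (a C i) + sgn (suc i) * fromℕ K (a C suc i)  ≈⟨ +-congʳ (*-assoc (- 1#) (sgn i) _) ⟩
      - 1# * (sgn i * fromℕ K (a C i)) + sgn (suc i) * fromℕ K (a C suc i) ∎
      where i = toℕ s

  ∑±C-stable : ∀ {a L} → a ℕ.< L → ∑±C a (suc L) ≈ ∑±C a L
  ∑±C-stable {a} {L} a<L = begin
    ∑±C a (suc L)                          ≈⟨ ∑-snoc L (λ s → sgn s * fromℕ K (a C s)) ⟩
    ∑±C a L + sgn L * fromℕ K (a C L)      ≡⟨ ≡.cong (λ u → ∑±C a L + sgn L * fromℕ K u) (k>n⇒nCk≡0 a<L) ⟩
    ∑±C a L + sgn L * 0#                   ≈⟨ +-congˡ (zeroʳ _) ⟩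
    ∑±C a L + 0#                           ≈⟨ +-identityʳ _ ⟩
    ∑±C a L                                ∎

  ∑±C-suc : ∀ {a L} → suc a ℕ.< L → ∑±C (suc a) L ≈ 0#
  ∑±C-suc {a} {suc L} (s≤s a<L) = begin
    ∑±C (suc a) (suc L)        ≈⟨ ∑±C-pascal a L ⟩
    ∑±C a (suc L) - ∑±C a L    ≈⟨ +-congʳ (∑±C-stable a<L) ⟩
    ∑±C a L - ∑±C a L          ≈⟨ -‿inverseʳ _ ⟩
    0#                         ∎

  mCn*∑±C[m∸n]≈𝟙[m≡n] : ∀ m n L → m ℕ.< n ℕ.+ L →
                        fromℕ K (m C n) * ∑±C (m ℕ.∸ n) L ≈ 𝟙 ⌊ m ℕ.≟ n ⌋
  mCn*∑±C[m∸n]≈𝟙[m≡n] m n L m<n+L with m ℕ.≟ n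
  ... | yes ≡.refl = begin
    fromℕ K (m C m) * ∑±C (m ℕ.∸ m) L  ≡⟨ ≡.cong₂ (λ u v → fromℕ K u * ∑±C v L) (nCn≡1 m) (ℕ.n∸n≡0 m) ⟩
    fromℕ K 1 * ∑±C 0 L                ≈⟨ *-cong fromℕ-1 (∑±C-0 0<L) ⟩
    1# * 1#                            ≈⟨ *-identityˡ 1# ⟩
    1#                                 ∎
    where
    0<L : 0 ℕ.< L
    0<L = ℕ.+-cancelˡ-< m 0 L (≡.subst (ℕ._< m ℕ.+ L) (≡.sym (ℕ.+-identityʳ m)) m<n+L)
  ... | no m≢n with n ℕ.≤? m
  ...   | no n≰m = trans (*-congʳ (reflexive (≡.cong (fromℕ K) (k>n⇒nCk≡0 (ℕ.≰⇒> n≰m))))) (zeroˡ _)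
  ...   | yes n≤m = vanish (m ℕ.∸ n) ≡.refl
    where
    vanish : ∀ d → m ℕ.∸ n ≡ d → fromℕ K (m C n) * ∑±C d L ≈ 0#
    vanish zero    m∸n≡0   = contradiction (ℕ.≤-antisym (ℕ.m∸n≡0⇒m≤n m∸n≡0) n≤m) m≢n
    vanish (suc d) m∸n≡1+d = trans (*-congˡ (∑±C-suc 1+d<L)) (zeroʳ _)
      where
      1+d<L : suc d ℕ.< L
      1+d<L = ≡.subst₂ ℕ._<_ m∸n≡1+d (ℕ.m+n∸m≡n n L) (ℕ.∸-monoˡ-< m<n+L n≤m)

  ∑-inversion : ∀ m n L → m ℕ.< n ℕ.+ L →
    ∑[ s < L ] ((fromℕ K ((n ℕ.+ toℕ s) C n) * sgn (toℕ s)) * fromℕ K (m C (n ℕ.+ toℕ s))) ≈ 𝟙 ⌊ m ℕ.≟ n ⌋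
  ∑-inversion m n L m<n+L = begin
    ∑[ s < L ] ((fromℕ K ((n ℕ.+ toℕ s) C n) * sgn (toℕ s)) * fromℕ K (m C (n ℕ.+ toℕ s)))
      ≈⟨ sum-cong-≋ {L} (λ s → factor (toℕ s)) ⟩
    ∑[ s < L ] (fromℕ K (m C n) * (sgn (toℕ s) * fromℕ K ((m ℕ.∸ n) C toℕ s)))
      ≈⟨ *-distribˡ-sum {L} (fromℕ K (m C n)) _ ⟨
    fromℕ K (m C n) * ∑±C (m ℕ.∸ n) L
      ≈⟨ mCn*∑±C[m∸n]≈𝟙[m≡n] m n L m<n+L ⟩
    𝟙 ⌊ m ℕ.≟ n ⌋ ∎
    where
    open import Algebra.Properties.CommutativeSemigroup *-commutativeSemigroup using (xy∙z≈y∙xz; x∙yz≈y∙xz)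
    factor : ∀ s → (fromℕ K ((n ℕ.+ s) C n) * sgn s) * fromℕ K (m C (n ℕ.+ s))
                   ≈ fromℕ K (m C n) * (sgn s * fromℕ K ((m ℕ.∸ n) C s))
    factor s = begin
      (fromℕ K ((n ℕ.+ s) C n) * sgn s) * fromℕ K (m C (n ℕ.+ s))
        ≈⟨ xy∙z≈y∙xz _ _ _ ⟩
      sgn s * (fromℕ K ((n ℕ.+ s) C n) * fromℕ K (m C (n ℕ.+ s)))
        ≈⟨ *-congˡ (fromℕ-homo-* ((n ℕ.+ s) C n) (m C (n ℕ.+ s))) ⟨
      sgn s * fromℕ K (((n ℕ.+ s) C n) ℕ.* (m C (n ℕ.+ s)))
        ≡⟨ ≡.cong (λ u → sgn s * fromℕ K u) ([n+s]Cn*mC[n+s]≡mCn*[m∸n]Cs m n s) ⟩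
      sgn s * fromℕ K ((m C n) ℕ.* ((m ℕ.∸ n) C s))
        ≈⟨ *-congˡ (fromℕ-homo-* (m C n) ((m ℕ.∸ n) C s)) ⟩
      sgn s * (fromℕ K (m C n) * fromℕ K ((m ℕ.∸ n) C s))
        ≈⟨ x∙yz≈y∙xz _ _ _ ⟩
      fromℕ K (m C n) * (sgn s * fromℕ K ((m ℕ.∸ n) C s)) ∎

  sumFromTo-empty : ∀ lo (f : ℕ → Carrier) → sumFromTo K lo lo f ≈ 0#
  sumFromTo-empty zero    f = refl
  sumFromTo-empty (suc h) f with h <ᵇ suc h | ℕ.<ᵇ-reflects-< h (suc h)
  ... | true  | _            = refl
  ... | false | ofⁿ h≮1+h    = contradiction (ℕ.n<1+n h) h≮1+h

  sumFromTo≈∑ : ∀ lo d (f : ℕ → Carrier) → sumFromTo K lo (lo ℕ.+ d) f ≈ ∑[ s < d ] f (lo ℕ.+ toℕ s)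
  sumFromTo≈∑ lo zero f rewrite ℕ.+-identityʳ lo = sumFromTo-empty lo f
  sumFromTo≈∑ lo (suc d) f rewrite ℕ.+-suc lo d with lo ℕ.+ d <ᵇ lo | ℕ.<ᵇ-reflects-< (lo ℕ.+ d) lo
  ... | true  | ofʸ lo+d<lo = contradiction lo+d<lo (ℕ.≤⇒≯ (ℕ.m≤m+n lo d))
  ... | false | _ = begin
    sumFromTo K lo (lo ℕ.+ d) f + f (lo ℕ.+ d)   ≈⟨ +-congʳ (sumFromTo≈∑ lo d f) ⟩
    ∑[ s < d ] f (lo ℕ.+ toℕ s) + f (lo ℕ.+ d)   ≈⟨ ∑-snoc d (λ t → f (lo ℕ.+ t)) ⟨
    ∑[ s < suc d ] f (lo ℕ.+ toℕ s)              ∎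

  𝟙[m≡n]≈mCn : ∀ {m n} → m ℕ.≤ n → 𝟙 ⌊ m ℕ.≟ n ⌋ ≈ fromℕ K (m C n)
  𝟙[m≡n]≈mCn {m} {n} m≤n with m ℕ.≟ n
  ... | yes ≡.refl = trans (sym fromℕ-1) (reflexive (≡.cong (fromℕ K) (≡.sym (nCn≡1 m))))
  ... | no m≢n     = reflexive (≡.cong (fromℕ K) (≡.sym (k>n⇒nCk≡0 (ℕ.≤∧≢⇒< m≤n m≢n))))

  module Coefficients {q k : ℕ} (1<q : 1 ℕ.< q) .{{_ : NonZero (q ^ k)}} (periodic : BinomialsPeriodic (q ^ k)) where

    Q = q ^ k

    cartier-coeff : ∀ {r} → AtLeastDigits q k r → r ℕ.< Q → ∀ X i →
      cartier K q r X i ≡ (if ⌊ (i ℤ.+ + r) %ℕ Q ℕ.≟ r ⌋ then X (i ℤ.+ + r) else 0#)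
    cartier-coeff {r} lower r<Q X i rewrite numDigits≡ 1<q lower r<Q =
      ≡.cong (λ b → if b then X (i ℤ.+ + r) else 0#) (⌊⌋-⇔ (Q∣∣i∣⇔[i+c]%ℕQ≡c Q i r<Q) _ _)

    hasse-coeff : ∀ {r} → r ℕ.< Q → ∀ X i → hasse K r X i ≈ fromℕ K (((i ℤ.+ + r) %ℕ Q) C r) * X (i ℤ.+ + r)
    hasse-coeff {r} r<Q X i = *-congʳ (binomᴷ-reduce Q periodic r<Q (i ℤ.+ + r))

    module _ {n : ℕ} (n-lower : AtLeastDigits q k n) (n<Q : n ℕ.< Q) where

      L = Q ∸ n

      n+L≡Q : n ℕ.+ L ≡ Q
      n+L≡Q = ℕ.m+[n∸m]≡n (ℕ.<⇒≤ n<Q)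

      n+s<Q : ∀ s → s ℕ.< L → n ℕ.+ s ℕ.< Q
      n+s<Q s s<L = ≡.subst (n ℕ.+ s ℕ.<_) n+L≡Q (ℕ.+-monoʳ-< n s<L)

      shift-index : ∀ i s → (i ℤ.- + s) ℤ.+ + (n ℕ.+ s) ≡ i ℤ.+ + n
      shift-index i s = ≡.trans (≡.cong (λ t → (i ℤ.- + s) ℤ.+ t) (ℤ.pos-+ n s)) (cancel i (+ n) (+ s))
        where
        cancel : ∀ i n s → (i ℤ.- s) ℤ.+ (n ℤ.+ s) ≡ i ℤ.+ n
        cancel = ℤ-Solver.solve-∀

      sumSeries≈∑ : ∀ F i → sumSeries K n Q F i ≈ ∑[ s < L ] F (n ℕ.+ toℕ s) i
      sumSeries≈∑ F i = trans (reflexive (≡.cong (λ h → sumFromTo K n h (λ r → F r i)) (≡.sym n+L≡Q)))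
                              (sumFromTo≈∑ n L (λ r → F r i))

      cartier≈∑hasse : ∀ X → eqₛ K (cartier K q n X)
        (sumSeries K n Q (λ r → scaleShift K (fromℤ K (binomℤ (+ r) n) * pow K (- 1#) (r ∸ n)) (r ∸ n) (hasse K r X)))
      cartier≈∑hasse X i = begin
        cartier K q n X i                       ≡⟨ cartier-coeff n-lower n<Q X i ⟩
        (if ⌊ j₀ ℕ.≟ n ⌋ then X j else 0#)      ≈⟨ if≈𝟙* _ (X j) ⟩
        𝟙 ⌊ j₀ ℕ.≟ n ⌋ * X j                   ≈⟨ *-congʳ (∑-inversion j₀ n L j₀<n+L) ⟨
        (∑[ s < L ] a (toℕ s)) * X j            ≈⟨ *-distribʳ-sum {L} (X j) (λ s → a (toℕ s)) ⟩
        ∑[ s < L ] (a (toℕ s) * X j)            ≈⟨ sum-cong-≋ {L} (λ s → term (toℕ s) (toℕ<n s)) ⟨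
        ∑[ s < L ] F (n ℕ.+ toℕ s) i            ≈⟨ sumSeries≈∑ F i ⟨
        sumSeries K n Q F i                     ∎
        where
        j = i ℤ.+ + n
        j₀ = j %ℕ Q
        j₀<n+L : j₀ ℕ.< n ℕ.+ L
        j₀<n+L = ≡.subst (j₀ ℕ.<_) (≡.sym n+L≡Q) (n%ℕd<d j Q)
        F = λ r → scaleShift K (fromℤ K (binomℤ (+ r) n) * pow K (- 1#) (r ∸ n)) (r ∸ n) (hasse K r X)
        a : ℕ → Carrier
        a s = (fromℕ K ((n ℕ.+ s) C n) * sgn s) * fromℕ K (j₀ C (n ℕ.+ s))
        term : ∀ s → s ℕ.< L → F (n ℕ.+ s) i ≈ a s * X j
        term s s<L = begin
          F r i                                   ≡⟨ ≡.cong (λ d → (b * sgn d) * hasse K r X (i ℤ.- + d)) (ℕ.m+n∸m≡n n s) ⟩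
          (b * sgn s) * hasse K r X (i ℤ.- + s)   ≈⟨ *-congˡ (hasse-coeff (n+s<Q s s<L) X (i ℤ.- + s)) ⟩
          (b * sgn s) * (fromℕ K ((t %ℕ Q) C r) * X t)
                                                  ≡⟨ ≡.cong (λ u → (b * sgn s) * (fromℕ K ((u %ℕ Q) C r) * X u)) (shift-index i s) ⟩
          (b * sgn s) * (fromℕ K (j₀ C r) * X j)  ≈⟨ *-assoc _ _ _ ⟨
          a s * X j                               ∎
          where
          r = n ℕ.+ s
          b = fromℕ K (r C n)
          t = (i ℤ.- + s) ℤ.+ + r

      hasse≈∑cartier : ∀ X → eqₛ K (hasse K n X)
        (sumSeries K n Q (λ r → scaleShift K (fromℤ K (binomℤ (+ r) n)) (r ∸ n) (cartier K q r X)))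
      hasse≈∑cartier X i = begin
        hasse K n X i                            ≈⟨ hasse-coeff n<Q X i ⟩
        fromℕ K (j₀ C n) * X j                   ≈⟨ *-congʳ (∑-selection j₀ n L j₀<n+L) ⟨
        (∑[ s < L ] a (toℕ s)) * X j             ≈⟨ *-distribʳ-sum {L} (X j) (λ s → a (toℕ s)) ⟩
        ∑[ s < L ] (a (toℕ s) * X j)             ≈⟨ sum-cong-≋ {L} (λ s → term (toℕ s) (toℕ<n s)) ⟨
        ∑[ s < L ] F (n ℕ.+ toℕ s) i             ≈⟨ sumSeries≈∑ F i ⟨
        sumSeries K n Q F i                      ∎
        where
        j = i ℤ.+ + n
        j₀ = j %ℕ Q
        j₀<n+L : j₀ ℕ.< n ℕ.+ L
        j₀<n+L = ≡.subst (j₀ ℕ.<_) (≡.sym n+L≡Q) (n%ℕd<d j Q)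
        F = λ r → scaleShift K (fromℤ K (binomℤ (+ r) n)) (r ∸ n) (cartier K q r X)
        a : ℕ → Carrier
        a s = fromℕ K ((n ℕ.+ s) C n) * 𝟙 ⌊ j₀ ℕ.≟ n ℕ.+ s ⌋
        term : ∀ s → s ℕ.< L → F (n ℕ.+ s) i ≈ a s * X j
        term s s<L = begin
          F r i                                         ≡⟨ ≡.cong (λ d → b * cartier K q r X (i ℤ.- + d)) (ℕ.m+n∸m≡n n s) ⟩
          b * cartier K q r X (i ℤ.- + s)               ≡⟨ ≡.cong (b *_) (cartier-coeff r-lower (n+s<Q s s<L) X (i ℤ.- + s)) ⟩
          b * (if ⌊ (t %ℕ Q) ℕ.≟ r ⌋ then X t else 0#)  ≡⟨ ≡.cong (λ u → b * (if ⌊ (u %ℕ Q) ℕ.≟ r ⌋ then X u else 0#)) (shift-index i s) ⟩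
          b * (if ⌊ j₀ ℕ.≟ r ⌋ then X j else 0#)        ≈⟨ *-congˡ (if≈𝟙* _ (X j)) ⟩
          b * (𝟙 ⌊ j₀ ℕ.≟ r ⌋ * X j)                    ≈⟨ *-assoc _ _ _ ⟨
          a s * X j                                     ∎
          where
          r = n ℕ.+ s
          b = fromℕ K (r C n)
          t = (i ℤ.- + s) ℤ.+ + r
          r-lower = AtLeastDigits-mono n-lower (ℕ.m≤m+n n s)

    cartier≈hasse-top : ∀ X → eqₛ K (cartier K q (Q ∸ 1) X) (hasse K (Q ∸ 1) X)
    cartier≈hasse-top X i = begin
      cartier K q N X i                    ≡⟨ cartier-coeff N-lower N<Q X i ⟩
      (if ⌊ j₀ ℕ.≟ N ⌋ then X j else 0#)   ≈⟨ if≈𝟙* _ (X j) ⟩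
      𝟙 ⌊ j₀ ℕ.≟ N ⌋ * X j                ≈⟨ *-congʳ (𝟙[m≡n]≈mCn (ℕ.<⇒≤pred (n%ℕd<d j Q))) ⟩
      fromℕ K (j₀ C N) * X j               ≈⟨ hasse-coeff N<Q X i ⟨
      hasse K N X i                        ∎
      where
      N = Q ∸ 1
      j = i ℤ.+ + N
      j₀ = j %ℕ Q
      N<Q : N ℕ.< Q
      N<Q = ≡.subst (N ℕ.<_) (ℕ.suc-pred Q) (ℕ.n<1+n N)
      N-lower : AtLeastDigits q k N
      N-lower m m<k = ℕ.<⇒≤pred (ℕ.^-monoʳ-< q 1<q m<k)

digit-bounds : ∀ {q k n} .{{_ : NonZero q}} → (1 ≤ k × q ^ (k ∸ 1) ≤ n × n < q ^ k) ⊎ (n ≡ 0 × k ≡ 0) →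
  AtLeastDigits q k n × n < q ^ k
digit-bounds {q} (inj₁ (_ , q^[k-1]≤n , n<q^k)) =
  (λ m m<k → ℕ.≤-trans (ℕ.^-monoʳ-≤ q (ℕ.<⇒≤pred m<k)) q^[k-1]≤n) , n<q^k
digit-bounds (inj₂ (≡.refl , ≡.refl)) = (λ _ ()) , s≤s z≤n

mainTheorem1 : ∀ {c ℓ : Level} (K : CommutativeRing c ℓ) → IsField K →
    (p : ℕ) → Prime p → HasCharacteristic K p → IsPerfect K p →
    (a : ℕ) → 1 ≤ a → (k n : ℕ) →
    ((1 ≤ k × (p ^ a) ^ (k ∸ 1) ≤ n × n < (p ^ a) ^ k) ⊎ (n ≡ 0 × k ≡ 0)) →
    (x : LaurentSeries K) →
    let open CommutativeRing K
        q = p ^ a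
        X = proj₁ x
    in eqₛ K (cartier K q n X)
         (sumSeries K n (q ^ k)
            (λ r → scaleShift K (fromℤ K (binomℤ (+ r) n) * pow K (- 1#) (r ∸ n)) (r ∸ n) (hasse K r X)))
     × eqₛ K (hasse K n X)
         (sumSeries K n (q ^ k)
            (λ r → scaleShift K (fromℤ K (binomℤ (+ r) n)) (r ∸ n) (cartier K q r X)))
     × eqₛ K (cartier K q (q ^ k ∸ 1) X) (hasse K (q ^ k ∸ 1) X)
mainTheorem1 K _ p p-prime char-p _ a 1≤a k n n-range (X , _) =
  cartier≈∑hasse n-lower n<Q X , hasse≈∑cartier n-lower n<Q X , cartier≈hasse-top X
  where
  q = p ^ a
  1<q : 1 ℕ.< q
  1<q = ℕ.^-monoʳ-< p (ℕ.nonTrivial⇒n>1 p {{prime⇒nonTrivial p-prime}}) 1≤a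
  instance
    q≢0 : NonZero q
    q≢0 = ℕ.>-nonZero (ℕ.<-trans (s≤s z≤n) 1<q)
    q^k≢0 : NonZero (q ^ k)
    q^k≢0 = ℕ.m^n≢0 q k
  periodic : BinomialsPeriodic K (q ^ k)
  periodic = ≡.subst (BinomialsPeriodic K) (≡.sym (ℕ.^-*-assoc p a k)) (binomᴷ-periodic-p^e K p-prime char-p (a ℕ.* k))
  open Coefficients K {q} {k} 1<q periodic
  n-lower : AtLeastDigits q k n
  n-lower = proj₁ (digit-bounds n-range)
  n<Q : n ℕ.< q ^ k
  n<Q = proj₂ (digit-bounds n-range)
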